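{- Let $L$ and $R$ be finite sets of edges (2-element subsets of $[n]$) and $M$ a finite set of triangles (3-element subsets of $[n]$), where $L$ and $R$ may intersect and any of them may be empty, satisfying: (LR) there are no $\{l_1<l_2\}\in L$ and $\{r_1<r_2\}\in R$ with $r_1<l_1<r_2<l_2$; (LMR) there are no $\{v_1<v_2\}\in L\cup R$ and $\{w_1<w_2<w_3\}\in M$ with $w_1<v_1<w_2<v_2<w_3$; (MM) there are no $\{v_1<v_2<v_3\},\{w_1<w_2<w_3\}\in M$ with $v_1<w_1<v_2<w_2<v_3<w_3$. For an edge $e=\{v_1<v_2\}$ consider the conditions: (Le) there is no $\{l_1<l_2\}\in L$ with $v_1<l_1<v_2<l_2$; (Me) there is no $\{w_1<w_2<w_3\}\in M$ with $w_1<v_1<w_2<v_2<w_3$; (Re) there is no $\{r_1<r_2\}\in R$ with $r_1<v_1<r_2<v_2$. Let $V\subseteq[n]$ with $|V|\ge3$, and regard $V$ as the set of points $\gamma_2(t_i)$, $i\in V$, on the parabola $\gamma_2$. If every edge of the convex polygon $P=\operatorname{conv}(V)$ satisfies (Le), (Me) and (Re), then there is a triangulation $T$ of $P$ with vertex set $V$ such that every edge of $T$ satisfies (Le), (Me) and (Re).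
   Context: $\gamma_2=\{(t,t^2):t\in\mathbb{R}\}$; fixed reals $t_1<\dots<t_n$, and the point $\gamma_2(t_i)$ is identified with $i\in[n]$, so the points $\gamma_2(t_i)$, $i\in V$, are in convex position and the edges of $P$ are the segments between consecutive vertices of this convex polygon. -}

module Defs where

open import Data.Nat using (ℕ)
open import Data.Fin using (Fin; _<_)
open import Data.Fin.Subset using (Subset; _∈_)
open import Data.Product using (_×_; _,_; ∃-syntax)
open import Data.List using (List; _++_)
open import Data.List.Relation.Unary.All using (All)
import Data.List.Membership.Propositional as LM
open import Relation.Nullary using (¬_)
open import Data.Sum using (_⊎_)

-- Vertices are elements of Fin n (the index i stands for the point γ₂(t_i)).
-- An edge {v₁ < v₂} is represented by the ordered pair (v₁ , v₂) with v₁ < v₂;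
-- a triangle {w₁ < w₂ < w₃} by (w₁ , w₂ , w₃) with w₁ < w₂ < w₃.
Edge : ℕ → Set
Edge n = Fin n × Fin n

Tri : ℕ → Set
Tri n = Fin n × Fin n × Fin n

IsEdge : ∀ {n} → Edge n → Set
IsEdge (a , b) = a < b

IsTri : ∀ {n} → Tri n → Set
IsTri (a , b , c) = a < b × b < c

Interleave : ∀ {n} → Fin n → Fin n → Fin n → Fin n → Set
Interleave x y z w = x < y × y < z × z < w

CondLR : ∀ {n} → List (Edge n) → List (Edge n) → Set
CondLR {n} L R = ∀ {l₁ l₂ r₁ r₂ : Fin n} → (l₁ , l₂) LM.∈ L → (r₁ , r₂) LM.∈ R →
  ¬ Interleave r₁ l₁ r₂ l₂

CondLMR : ∀ {n} → List (Edge n) → List (Tri n) → List (Edge n) → Set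
CondLMR {n} L M R = ∀ {v₁ v₂ w₁ w₂ w₃ : Fin n} → (v₁ , v₂) LM.∈ (L ++ R) →
  (w₁ , w₂ , w₃) LM.∈ M → ¬ (w₁ < v₁ × Interleave v₁ w₂ v₂ w₃)

CondMM : ∀ {n} → List (Tri n) → Set
CondMM {n} M = ∀ {v₁ v₂ v₃ w₁ w₂ w₃ : Fin n} → (v₁ , v₂ , v₃) LM.∈ M →
  (w₁ , w₂ , w₃) LM.∈ M → ¬ (v₁ < w₁ × w₁ < v₂ × v₂ < w₂ × w₂ < v₃ × v₃ < w₃)

CondLe : ∀ {n} → List (Edge n) → Edge n → Set
CondLe {n} L (v₁ , v₂) = ∀ {l₁ l₂ : Fin n} → (l₁ , l₂) LM.∈ L → ¬ Interleave v₁ l₁ v₂ l₂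

CondMe : ∀ {n} → List (Tri n) → Edge n → Set
CondMe {n} M (v₁ , v₂) = ∀ {w₁ w₂ w₃ : Fin n} → (w₁ , w₂ , w₃) LM.∈ M →
  ¬ (w₁ < v₁ × Interleave v₁ w₂ v₂ w₃)

CondRe : ∀ {n} → List (Edge n) → Edge n → Set
CondRe {n} R (v₁ , v₂) = ∀ {r₁ r₂ : Fin n} → (r₁ , r₂) LM.∈ R → ¬ Interleave r₁ v₁ r₂ v₂

AllConds : ∀ {n} → List (Edge n) → List (Tri n) → List (Edge n) → Edge n → Set
AllConds L M R e = CondLe L e × CondMe M e × CondRe R e

SegmentOf : ∀ {n} → Subset n → Edge n → Set
SegmentOf V (a , b) = a < b × a ∈ V × b ∈ V

-- Edges of the convex polygon conv(V): consecutive vertices in the cyclic order,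
-- i.e. {a<b} ⊆ V with no vertex of V strictly between a and b, or a = min V and
-- b = max V (no vertex of V outside [a,b]).
PolygonEdge : ∀ {n} → Subset n → Edge n → Set
PolygonEdge {n} V (a , b) = SegmentOf V (a , b) ×
  ((∀ (c : Fin n) → c ∈ V → ¬ (a < c × c < b)) ⊎
   (∀ (c : Fin n) → c ∈ V → ¬ (c < a) × ¬ (b < c)))

-- Two segments {a<b}, {c<d} between points in convex position cross (their
-- relative interiors meet) iff their endpoints strictly interleave.
Cross : ∀ {n} → Edge n → Edge n → Set
Cross (a , b) (c , d) = Interleave a c b d

NonCrossing : ∀ {n} → Edge n → Edge n → Set
NonCrossing e f = ¬ Cross e f × ¬ Cross f e

-- A triangulation of conv(V) with vertex set V, given by its edge set T:
-- a maximal set of pairwise non-crossing segments between points of V.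
record IsTriangulation {n} (V : Subset n) (T : List (Edge n)) : Set where
  field
    segments    : All (SegmentOf V) T
    noncrossing : ∀ {e f} → e LM.∈ T → f LM.∈ T → NonCrossing e f
    maximal     : ∀ (e : Edge n) → SegmentOf V e →
                  e LM.∈ T ⊎ (∃[ f ] (f LM.∈ T × ¬ NonCrossing e f))

-- Call a segment good when it satisfies (Le), (Me) and (Re).  Starting from
-- the hull edge {min V < max V}, which is a side of P and hence good, split
-- recursively: in a good chord {a < b} with vertices of V strictly inside,
-- let c be the last vertex of V in (a, b) for which {a < c} is good (the
-- successor of a qualifies, being a side of P).  Then {c < b} is good too: an
-- edge of R or a triangle of M obstructing {c < b} has its second (resp.
-- middle) vertex r in V, since otherwise it would obstruct the side of P
-- passing over r; and then (LR), (LMR) or (MM), together with the goodness of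
-- {a < b} and {a < c}, make {a < r} good, against the choice of c.
module Submission where

open import Defs
open import Data.Nat as ℕ using (ℕ; _∸_)
import Data.Nat.Induction as ℕ
import Data.Nat.Properties as ℕₚ
open import Data.Nat.Properties
  using (<-trans; <-≤-trans; ≤-<-trans; ≤-trans; ≤-refl; <⇒≤; <⇒≱; ≮⇒≥; ∸-monoˡ-<; ∸-monoʳ-<)
open import Data.Fin using (Fin; toℕ; _<_; _≤_)
open import Data.Fin.Properties using (≤-antisym; _<?_; any?; toℕ-injective)
open import Data.Fin.Subset using (Subset; _∈_; ∣_∣; ⁅_⁆) renaming (⊥ to ∅)
open import Data.Fin.Subset.Properties
  using (_∈?_; nonempty?; p⊆q⇒∣p∣≤∣q∣; ∣⊥∣≡0; ∣⁅x⁆∣≡1; x∈⁅x⁆)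
open import Data.Fin.Induction using (<-wellFounded; >-wellFounded)
open import Data.Product using (_×_; _,_; proj₁; proj₂; ∃; ∃₂; ∃-syntax)
open import Data.Sum using (_⊎_; inj₁; inj₂)
open import Data.List using (List; []; _∷_; _++_)
open import Data.List.Relation.Unary.All as All using (All; []; _∷_)
open import Data.List.Relation.Unary.All.Properties using (++⁺)
open import Data.List.Relation.Unary.Any using (here; there)
import Data.List.Membership.Propositional as LM
open import Data.List.Membership.Propositional.Properties using (∈-++⁺ˡ; ∈-++⁺ʳ; ∈-++⁻)
open import Data.List.Relation.Binary.Subset.Propositional using (_⊆_)
open import Data.Empty using (⊥; ⊥-elim)
open import Function using (_∘_; _on_)
open import Induction.WellFounded using (WellFounded; Acc; acc)
open import Relation.Binary using (Rel; Connex)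
import Relation.Binary.Definitions as B
import Relation.Binary.Construct.On as On
open import Relation.Binary.PropositionalEquality using (_≡_; refl; sym; cong₂; subst)
open import Relation.Nullary using (¬_; Dec; yes; no)
open import Relation.Nullary.Decidable using (_×-dec_; ¬?; map′)
open import Relation.Unary using (Pred; Decidable)

private
  variable
    n : ℕ
    a b c p q : Fin n

<-≤-connex : Connex (_<_ {n}) (_≤_ {n})
<-≤-connex i j = ℕₚ.<-≤-connex (toℕ i) (toℕ j)

module _ {ℓ r} {_≺_ : Rel (Fin n) ℓ} (≺-wellFounded : WellFounded _≺_) (_≺?_ : B.Decidable _≺_)
         {P : Pred (Fin n) r} (P? : Decidable P) where

  ≺-minimal : ∀ {w} → P w → ∃[ x ] (P x × ∀ {y} → P y → ¬ y ≺ x)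
  ≺-minimal {w} = go (≺-wellFounded w)
    where
    go : ∀ {w} → Acc _≺_ w → P w → ∃[ x ] (P x × ∀ {y} → P y → ¬ y ≺ x)
    go {w} (acc rs) pw with any? (λ y → P? y ×-dec y ≺? w)
    ... | yes (y , py , y≺w) = go (rs y≺w) py
    ... | no nothing-below   = w , pw , λ py y≺w → nothing-below (_ , py , y≺w)

module _ {r} {P : Pred (Fin n) r} (P? : Decidable P) where

  minimum : ∀ {w} → P w → ∃[ x ] (P x × ∀ {y} → P y → x ≤ y)
  minimum pw with ≺-minimal <-wellFounded _<?_ P? pw
  ... | x , px , minimal = x , px , ≮⇒≥ ∘ minimal

  maximum : ∀ {w} → P w → ∃[ x ] (P x × ∀ {y} → P y → y ≤ x)
  maximum pw with ≺-minimal >-wellFounded (λ y x → x <? y) P? pw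
  ... | x , px , maximal = x , px , ≮⇒≥ ∘ maximal

interleave? : (x y z w : Fin n) → Dec (Interleave x y z w)
interleave? x y z w = x <? y ×-dec y <? z ×-dec z <? w

∀∈? : ∀ {ℓ r} {A : Set ℓ} {P : Pred A r} → Decidable P → (xs : List A) →
      Dec (∀ {x} → x LM.∈ xs → P x)
∀∈? P? xs = map′ All.lookup All.tabulate (All.all? P? xs)

CondLe? : (L : List (Edge n)) (e : Edge n) → Dec (CondLe L e)
CondLe? L (v₁ , v₂) =
  map′ (λ h {l₁} {l₂} → h {l₁ , l₂}) (λ h {l} → h {proj₁ l} {proj₂ l})
    (∀∈? (λ (l₁ , l₂) → ¬? (interleave? v₁ l₁ v₂ l₂)) L)

CondMe? : (M : List (Tri n)) (e : Edge n) → Dec (CondMe M e)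
CondMe? M (v₁ , v₂) =
  map′ (λ h {w₁} {w₂} {w₃} → h {w₁ , w₂ , w₃})
       (λ h {w} → h {proj₁ w} {proj₁ (proj₂ w)} {proj₂ (proj₂ w)})
    (∀∈? (λ (w₁ , w₂ , w₃) → ¬? (w₁ <? v₁ ×-dec interleave? v₁ w₂ v₂ w₃)) M)

CondRe? : (R : List (Edge n)) (e : Edge n) → Dec (CondRe R e)
CondRe? R (v₁ , v₂) =
  map′ (λ h {r₁} {r₂} → h {r₁ , r₂}) (λ h {r} → h {proj₁ r} {proj₂ r})
    (∀∈? (λ (r₁ , r₂) → ¬? (interleave? r₁ v₁ r₂ v₂)) R)

AllConds? : (L : List (Edge n)) (M : List (Tri n)) (R : List (Edge n)) (e : Edge n) →
            Dec (AllConds L M R e)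
AllConds? L M R e = CondLe? L e ×-dec CondMe? M e ×-dec CondRe? R e

CondLe-shrinkˡ : ∀ {L : List (Edge n)} → a ≤ c → CondLe L (a , b) → CondLe L (c , b)
CondLe-shrinkˡ a≤c le l∈ (c<l₁ , l₁<b , b<l₂) = le l∈ (≤-<-trans a≤c c<l₁ , l₁<b , b<l₂)

CondRe-shrinkʳ : ∀ {R : List (Edge n)} → q ≤ b → CondRe R (a , b) → CondRe R (a , q)
CondRe-shrinkʳ q≤b re r∈ (r₁<a , a<r₂ , r₂<q) = re r∈ (r₁<a , a<r₂ , <-≤-trans r₂<q q≤b)

module Obstructions {L R : List (Edge n)} {M : List (Tri n)}
  (hLR : CondLR L R) (hLMR : CondLMR L M R) (hMM : CondMM M) where

  Good : Edge n → Set
  Good = AllConds L M R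

  good-past-R : ∀ {r₁ r₂} → (r₁ , r₂) LM.∈ R → a ≤ r₁ → r₁ < c → c < r₂ → r₂ < b →
                Good (a , b) → Good (a , c) → Good (a , r₂)
  good-past-R {a = a} {r₁ = r₁} {r₂} r∈ a≤r₁ r₁<c c<r₂ r₂<b (_ , _ , re-ab) (le-ac , me-ac , _) =
    le , me , CondRe-shrinkʳ (<⇒≤ r₂<b) re-ab
    where
    le : CondLe L (a , r₂)
    le {l₁} l∈ (a<l₁ , l₁<r₂ , r₂<l₂) with <-≤-connex r₁ l₁
    ... | inj₁ r₁<l₁ = hLR l∈ r∈ (r₁<l₁ , l₁<r₂ , r₂<l₂)
    ... | inj₂ l₁≤r₁ = le-ac l∈ (a<l₁ , ≤-<-trans l₁≤r₁ r₁<c , <-trans c<r₂ r₂<l₂)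

    me : CondMe M (a , r₂)
    me {w₂ = w₂} w∈ (w₁<a , a<w₂ , w₂<r₂ , r₂<w₃) with <-≤-connex r₁ w₂
    ... | inj₁ r₁<w₂ = hLMR (∈-++⁺ʳ L r∈) w∈ (<-≤-trans w₁<a a≤r₁ , r₁<w₂ , w₂<r₂ , r₂<w₃)
    ... | inj₂ w₂≤r₁ = me-ac w∈ (w₁<a , a<w₂ , ≤-<-trans w₂≤r₁ r₁<c , <-trans c<r₂ r₂<w₃)

  good-past-M : ∀ {w₁ w₂ w₃} → (w₁ , w₂ , w₃) LM.∈ M → a ≤ w₁ → w₁ < c → c < w₂ → w₂ < b → b < w₃ →
                Good (a , b) → Good (a , c) → Good (a , w₂)
  good-past-M {a = a} {c = c} {b = b} {w₁} {w₂} {w₃} w∈ a≤w₁ w₁<c c<w₂ w₂<b b<w₃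
              (le-ab , me-ab , re-ab) (le-ac , me-ac , _) =
    le , me , CondRe-shrinkʳ (<⇒≤ w₂<b) re-ab
    where
    le-inside : ∀ {l₁ l₂} → (l₁ , l₂) LM.∈ L → a < l₁ → l₁ < w₂ → w₂ < l₂ → l₂ ≤ b → ⊥
    le-inside {l₁} l∈ a<l₁ l₁<w₂ w₂<l₂ l₂≤b with <-≤-connex w₁ l₁
    ... | inj₁ w₁<l₁ = hLMR (∈-++⁺ˡ l∈) w∈ (w₁<l₁ , l₁<w₂ , w₂<l₂ , ≤-<-trans l₂≤b b<w₃)
    ... | inj₂ l₁≤w₁ = le-ac l∈ (a<l₁ , ≤-<-trans l₁≤w₁ w₁<c , <-trans c<w₂ w₂<l₂)

    le : CondLe L (a , w₂)
    le {l₂ = l₂} l∈ (a<l₁ , l₁<w₂ , w₂<l₂) with <-≤-connex b l₂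
    ... | inj₁ b<l₂ = le-ab l∈ (a<l₁ , <-trans l₁<w₂ w₂<b , b<l₂)
    ... | inj₂ l₂≤b = le-inside l∈ a<l₁ l₁<w₂ w₂<l₂ l₂≤b

    me-inside : ∀ {v₁ v₂ v₃} → (v₁ , v₂ , v₃) LM.∈ M → v₁ < a → a < v₂ → v₂ < w₂ → w₂ < v₃ → v₃ ≤ b → ⊥
    me-inside {v₂ = v₂} v∈ v₁<a a<v₂ v₂<w₂ w₂<v₃ v₃≤b with <-≤-connex w₁ v₂
    ... | inj₁ w₁<v₂ = hMM v∈ w∈ (<-≤-trans v₁<a a≤w₁ , w₁<v₂ , v₂<w₂ , w₂<v₃ , ≤-<-trans v₃≤b b<w₃)
    ... | inj₂ v₂≤w₁ = me-ac v∈ (v₁<a , a<v₂ , ≤-<-trans v₂≤w₁ w₁<c , <-trans c<w₂ w₂<v₃)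

    me : CondMe M (a , w₂)
    me {w₃ = v₃} v∈ (v₁<a , a<v₂ , v₂<w₂ , w₂<v₃) with <-≤-connex b v₃
    ... | inj₁ b<v₃ = me-ab v∈ (v₁<a , a<v₂ , <-trans v₂<w₂ w₂<b , b<v₃)
    ... | inj₂ v₃≤b = me-inside v∈ v₁<a a<v₂ v₂<w₂ w₂<v₃ v₃≤b

NoVertexBetween : Subset n → Fin n → Fin n → Set
NoVertexBetween V a b = ∀ c → c ∈ V → ¬ (a < c × c < b)

Consecutive : Subset n → Edge n → Set
Consecutive V (a , b) = SegmentOf V (a , b) × NoVertexBetween V a b

module _ {V : Subset n} where

  straddle : c ∈ V → b ∈ V → c < p → p ≤ b →
             ∃₂ λ u u′ → Consecutive V (u , u′) × c ≤ u × u < p × p ≤ u′ × u′ ≤ b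
  straddle {p = p} c∈ b∈ c<p p≤b
    with maximum (λ x → x ∈? V ×-dec x <? p) (c∈ , c<p)
  ... | u , (u∈ , u<p) , below-p
    with minimum (λ x → x ∈? V ×-dec u <? x) (b∈ , <-≤-trans u<p p≤b)
  ... | u′ , (u′∈ , u<u′) , above-u =
    u , u′ , ((u<u′ , u∈ , u′∈) , gap) , below-p (c∈ , c<p) , u<p , p≤u′ ,
    above-u (b∈ , <-≤-trans u<p p≤b)
    where
    gap : NoVertexBetween V u u′
    gap z z∈ (u<z , z<u′) = <⇒≱ z<u′ (above-u (z∈ , u<z))
    p≤u′ : p ≤ u′
    p≤u′ = ≮⇒≥ λ u′<p → <⇒≱ u<u′ (below-p (u′∈ , u′<p))

  vertex-unless-straddled :
    c ∈ V → b ∈ V → c < p → p < b →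
    (∀ {u u′} → Consecutive V (u , u′) → c ≤ u → u < p → p < u′ → u′ ≤ b → ⊥) → p ∈ V
  vertex-unless-straddled c∈ b∈ c<p p<b no-straddle
    with straddle c∈ b∈ c<p (<⇒≤ p<b)
  ... | u , u′ , side@(seg , _) , c≤u , u<p , p≤u′ , u′≤b with ℕₚ.m≤n⇒m<n∨m≡n p≤u′
  ... | inj₁ p<u′ = ⊥-elim (no-straddle side c≤u u<p p<u′ u′≤b)
  ... | inj₂ p≡u′ = subst (_∈ V) (sym (toℕ-injective p≡u′)) (proj₂ (proj₂ seg))

Inside : Fin n → Fin n → Edge n → Set
Inside a b (x , y) = a ≤ x × y ≤ b

Blocked : List (Edge n) → Edge n → Set
Blocked T e = e LM.∈ T ⊎ ∃[ f ] (f LM.∈ T × ¬ NonCrossing e f)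

Blocked-mono : ∀ {T T′ : List (Edge n)} {e} → T ⊆ T′ → Blocked T e → Blocked T′ e
Blocked-mono T⊆T′ (inj₁ e∈)             = inj₁ (T⊆T′ e∈)
Blocked-mono T⊆T′ (inj₂ (f , f∈ , ¬nc)) = inj₂ (f , T⊆T′ f∈ , ¬nc)

Inside⇒NonCrossing : ∀ {e} → Inside a b e → NonCrossing (a , b) e
Inside⇒NonCrossing (a≤x , y≤b) =
  (λ (_ , _ , b<y) → <⇒≱ b<y y≤b) , (λ (x<a , _ , _) → <⇒≱ x<a a≤x)

separated⇒NonCrossing : ∀ {r s} → p ≤ q → q ≤ c → c ≤ r → NonCrossing (p , q) (r , s)
separated⇒NonCrossing p≤q q≤c c≤r =
  (λ (_ , r<q , _) → <⇒≱ r<q (≤-trans q≤c c≤r)) ,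
  (λ (r<p , _ , _) → <⇒≱ r<p (≤-trans p≤q (≤-trans q≤c c≤r)))

swap-NonCrossing : ∀ {e f : Edge n} → NonCrossing e f → NonCrossing f e
swap-NonCrossing (e⋪f , f⋪e) = f⋪e , e⋪f

record Triangulates (V : Subset n) (Good : Edge n → Set) (a b : Fin n) (T : List (Edge n)) : Set where
  field
    outer       : (a , b) LM.∈ T
    segments    : All (SegmentOf V) T
    inside      : All (Inside a b) T
    good        : All Good T
    noncrossing : ∀ {e f} → e LM.∈ T → f LM.∈ T → NonCrossing e f
    maximal     : ∀ {e} → SegmentOf V e → Inside a b e → Blocked T e

module Construction (V : Subset n) (Good : Edge n → Set) where

  single : SegmentOf V (a , b) → Good (a , b) → NoVertexBetween V a b →
           Triangulates V Good a b ((a , b) ∷ [])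
  single {a = a} {b = b} seg gab gap = record
    { outer       = here refl
    ; segments    = seg ∷ []
    ; inside      = (≤-refl , ≤-refl) ∷ []
    ; good        = gab ∷ []
    ; noncrossing = λ { (here refl) (here refl) → Inside⇒NonCrossing (≤-refl , ≤-refl) }
    ; maximal     = maximal
    }
    where
    maximal : ∀ {e} → SegmentOf V e → Inside a b e → Blocked ((a , b) ∷ []) e
    maximal {x , y} (x<y , x∈ , y∈) (a≤x , y≤b) = inj₁ (here (cong₂ _,_ x≡a y≡b))
      where
      x≡a : x ≡ a
      x≡a = ≤-antisym (≮⇒≥ λ a<x → gap x x∈ (a<x , <-≤-trans x<y y≤b)) a≤x
      y≡b : y ≡ b
      y≡b = ≤-antisym y≤b (≮⇒≥ λ y<b → gap y y∈ (≤-<-trans a≤x x<y , y<b))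

  glue : ∀ {T₁ T₂} → SegmentOf V (a , b) → Good (a , b) → a < c → c < b →
         Triangulates V Good a c T₁ → Triangulates V Good c b T₂ →
         Triangulates V Good a b ((a , b) ∷ T₁ ++ T₂)
  glue {a = a} {b = b} {c = c} {T₁} {T₂} seg gab a<c c<b t₁ t₂ = record
    { outer       = here refl
    ; segments    = seg ∷ ++⁺ (segments t₁) (segments t₂)
    ; inside      = inside′
    ; good        = gab ∷ ++⁺ (good t₁) (good t₂)
    ; noncrossing = noncrossing′
    ; maximal     = maximal′
    }
    where
    open Triangulates
    T = (a , b) ∷ T₁ ++ T₂

    widenʳ : ∀ {e} → Inside a c e → Inside a b e
    widenʳ (a≤x , y≤c) = a≤x , ≤-trans y≤c (<⇒≤ c<b)
    widenˡ : ∀ {e} → Inside c b e → Inside a b e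
    widenˡ (c≤x , y≤b) = ≤-trans (<⇒≤ a<c) c≤x , y≤b

    inside′ : All (Inside a b) T
    inside′ = (≤-refl , ≤-refl) ∷
              ++⁺ (All.map widenʳ (inside t₁)) (All.map widenˡ (inside t₂))

    separated : ∀ {e f} → e LM.∈ T₁ → f LM.∈ T₂ → NonCrossing e f
    separated e∈ f∈
      with All.lookup (segments t₁) e∈ | All.lookup (inside t₁) e∈ | All.lookup (inside t₂) f∈
    ... | p<q , _ | _ , q≤c | c≤r , _ = separated⇒NonCrossing (<⇒≤ p<q) q≤c c≤r

    noncrossing′ : ∀ {e f} → e LM.∈ T → f LM.∈ T → NonCrossing e f
    noncrossing′ (here refl) f∈          = Inside⇒NonCrossing (All.lookup inside′ f∈)
    noncrossing′ e∈          (here refl) =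
      swap-NonCrossing (Inside⇒NonCrossing (All.lookup inside′ e∈))
    noncrossing′ (there e∈)  (there f∈) with ∈-++⁻ T₁ e∈ | ∈-++⁻ T₁ f∈
    ... | inj₁ e∈₁ | inj₁ f∈₁ = noncrossing t₁ e∈₁ f∈₁
    ... | inj₂ e∈₂ | inj₂ f∈₂ = noncrossing t₂ e∈₂ f∈₂
    ... | inj₁ e∈₁ | inj₂ f∈₂ = separated e∈₁ f∈₂
    ... | inj₂ e∈₂ | inj₁ f∈₁ = swap-NonCrossing (separated f∈₁ e∈₂)

    maximal′ : ∀ {e} → SegmentOf V e → Inside a b e → Blocked T e
    maximal′ {x , y} seg (a≤x , y≤b) with <-≤-connex c y | <-≤-connex x c
    ... | inj₂ y≤c | _        = Blocked-mono (there ∘ ∈-++⁺ˡ) (maximal t₁ seg (a≤x , y≤c))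
    ... | inj₁ _   | inj₂ c≤x = Blocked-mono (there ∘ ∈-++⁺ʳ T₁) (maximal t₂ seg (c≤x , y≤b))
    ... | inj₁ c<y | inj₁ x<c with <-≤-connex a x | <-≤-connex y b
    ...   | inj₁ a<x | _        =
      inj₂ (_ , there (∈-++⁺ˡ (outer t₁)) , λ (_ , ac⋪xy) → ac⋪xy (a<x , x<c , c<y))
    ...   | inj₂ _   | inj₁ y<b =
      inj₂ (_ , there (∈-++⁺ʳ T₁ (outer t₂)) , λ (xy⋪cb , _) → xy⋪cb (x<c , c<y , y<b))
    ...   | inj₂ x≤a | inj₂ b≤y = inj₁ (here (cong₂ _,_ (≤-antisym x≤a a≤x) (≤-antisym y≤b b≤y)))

  width : Edge n → ℕ
  width (a , b) = toℕ b ∸ toℕ a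

  module _ (split : ∀ {a b z} → SegmentOf V (a , b) → Good (a , b) → z ∈ V → a < z → z < b →
                    ∃[ c ] (c ∈ V × a < c × c < b × Good (a , c) × Good (c , b)))
    where

    triangulate : SegmentOf V (a , b) → Good (a , b) → ∃ (Triangulates V Good a b)
    triangulate {a = a} {b = b} = go (On.wellFounded width ℕ.<-wellFounded (a , b))
      where
      go : ∀ {a b} → Acc (ℕ._<_ on width) (a , b) →
           SegmentOf V (a , b) → Good (a , b) → ∃ (Triangulates V Good a b)
      go {a} {b} (acc rs) seg@(a<b , a∈ , b∈) gab with any? (λ z → z ∈? V ×-dec a <? z ×-dec z <? b)
      ... | no empty = _ , single seg gab (λ z z∈ (a<z , z<b) → empty (z , z∈ , a<z , z<b))
      ... | yes (z , z∈ , a<z , z<b) with split seg gab z∈ a<z z<b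
      ...   | c , c∈ , a<c , c<b , gac , gcb =
        _ , glue seg gab a<c c<b
              (proj₂ (go (rs (∸-monoˡ-< c<b (<⇒≤ a<c))) (a<c , a∈ , c∈) gac))
              (proj₂ (go (rs (∸-monoʳ-< a<c (<⇒≤ c<b))) (c<b , c∈ , b∈) gcb))

module Splitting {L R : List (Edge n)} {M : List (Tri n)}
  (hLR : CondLR L R) (hLMR : CondLMR L M R) (hMM : CondMM M)
  (V : Subset n) (consecutive-good : ∀ {e} → Consecutive V e → AllConds L M R e) where

  open Obstructions hLR hLMR hMM

  good-after-last : c ∈ V → b ∈ V → a < c → Good (a , b) → Good (a , c) →
                    (∀ {q} → q ∈ V → c < q → q < b → ¬ Good (a , q)) → Good (c , b)
  good-after-last {c = c} {b = b} {a = a} c∈ b∈ a<c gab@(le-ab , me-ab , re-ab) gac last =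
    CondLe-shrinkˡ (<⇒≤ a<c) le-ab , me , re
    where
    re : CondRe R (c , b)
    re {r₁} {r₂} r∈ (r₁<c , c<r₂ , r₂<b) with <-≤-connex r₁ a
    ... | inj₁ r₁<a = re-ab r∈ (r₁<a , <-trans a<c c<r₂ , r₂<b)
    ... | inj₂ a≤r₁ = last r₂∈ c<r₂ r₂<b (good-past-R r∈ a≤r₁ r₁<c c<r₂ r₂<b gab gac)
      where
      r₂∈ : r₂ ∈ V
      r₂∈ = vertex-unless-straddled c∈ b∈ c<r₂ r₂<b λ side c≤u u<r₂ r₂<u′ _ →
              proj₂ (proj₂ (consecutive-good side)) r∈ (<-≤-trans r₁<c c≤u , u<r₂ , r₂<u′)

    me : CondMe M (c , b)
    me {w₁} {w₂} w∈ (w₁<c , c<w₂ , w₂<b , b<w₃) with <-≤-connex w₁ a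
    ... | inj₁ w₁<a = me-ab w∈ (w₁<a , <-trans a<c c<w₂ , w₂<b , b<w₃)
    ... | inj₂ a≤w₁ = last w₂∈ c<w₂ w₂<b (good-past-M w∈ a≤w₁ w₁<c c<w₂ w₂<b b<w₃ gab gac)
      where
      w₂∈ : w₂ ∈ V
      w₂∈ = vertex-unless-straddled c∈ b∈ c<w₂ w₂<b λ side c≤u u<w₂ w₂<u′ u′≤b →
              proj₁ (proj₂ (consecutive-good side)) w∈
                (<-≤-trans w₁<c c≤u , u<w₂ , w₂<u′ , ≤-<-trans u′≤b b<w₃)

  split : ∀ {z} → SegmentOf V (a , b) → Good (a , b) → z ∈ V → a < z → z < b →
          ∃[ c ] (c ∈ V × a < c × c < b × Good (a , c) × Good (c , b))
  split {a = a} {b = b} (a<b , a∈ , b∈) gab z∈ a<z z<b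
    with minimum (λ x → x ∈? V ×-dec a <? x) (z∈ , a<z)
  ... | s , (s∈ , a<s) , next
    with maximum (λ x → x ∈? V ×-dec a <? x ×-dec x <? b ×-dec AllConds? L M R (a , x))
                 (s∈ , a<s , ≤-<-trans (next (z∈ , a<z)) z<b , successor-good)
    where
    successor-good : Good (a , s)
    successor-good = consecutive-good ((a<s , a∈ , s∈) , λ y y∈ (a<y , y<s) →
                       <⇒≱ y<s (next (y∈ , a<y)))
  ... | c , (c∈ , a<c , c<b , gac) , last =
    c , c∈ , a<c , c<b , gac ,
    good-after-last c∈ b∈ a<c gab gac λ q∈ c<q q<b gaq →
      <⇒≱ c<q (last (q∈ , <-trans a<c c<q , q<b , gaq))

extremal-vertices : ∀ {V : Subset n} → 2 ℕ.≤ ∣ V ∣ →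
  ∃₂ λ a b → a ∈ V × b ∈ V × a < b × (∀ {x} → x ∈ V → a ≤ x × x ≤ b)
extremal-vertices {n = n} {V = V} 2≤∣V∣ with nonempty? V
... | no empty = ⊥-elim (<⇒≱ 2≤∣V∣ (ℕₚ.≤-trans ∣V∣≤0 ℕ.z≤n))
  where
  ∣V∣≤0 : ∣ V ∣ ℕ.≤ 0
  ∣V∣≤0 = subst (∣ V ∣ ℕ.≤_) (∣⊥∣≡0 n) (p⊆q⇒∣p∣≤∣q∣ {q = ∅} λ {x} x∈ → ⊥-elim (empty (x , x∈)))
... | yes (_ , x∈) with minimum (_∈? V) x∈ | maximum (_∈? V) x∈
...   | a , a∈ , lowest | b , b∈ , highest with <-≤-connex a b
...     | inj₁ a<b = a , b , a∈ , b∈ , a<b , λ y∈ → lowest y∈ , highest y∈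
...     | inj₂ b≤a =
  ⊥-elim (<⇒≱ 2≤∣V∣ (subst (∣ V ∣ ℕ.≤_) (∣⁅x⁆∣≡1 a) (p⊆q⇒∣p∣≤∣q∣ {q = ⁅ a ⁆} V⊆⁅a⁆)))
  where
  V⊆⁅a⁆ : ∀ {y} → y ∈ V → y ∈ ⁅ a ⁆
  V⊆⁅a⁆ y∈ = subst (_∈ ⁅ a ⁆) (≤-antisym (lowest y∈) (≤-trans (highest y∈) b≤a)) (x∈⁅x⁆ a)

hull-IsTriangulation : ∀ {V : Subset n} {Good T} → (∀ {x} → x ∈ V → a ≤ x × x ≤ b) →
                       Triangulates V Good a b T → IsTriangulation V T
hull-IsTriangulation bounds t = record
  { segments    = segments
  ; noncrossing = noncrossing
  ; maximal     = λ { _ seg@(_ , x∈ , y∈) → maximal seg (proj₁ (bounds x∈) , proj₂ (bounds y∈)) }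
  }
  where open Triangulates t

lemma3p8 : ∀ (n : _) (L R : List (Edge n)) (M : List (Tri n)) →
    All IsEdge L → All IsEdge R → All IsTri M →
    CondLR L R → CondLMR L M R → CondMM M →
    (V : Subset n) → 3 ℕ.≤ ∣ V ∣ →
    (∀ (e : Edge n) → PolygonEdge V e → AllConds L M R e) →
    ∃[ T ] (IsTriangulation V T × All (AllConds L M R) T)
lemma3p8 n L R M _ _ _ hLR hLMR hMM V 3≤∣V∣ sides-good
  with extremal-vertices (ℕₚ.≤-trans (ℕₚ.n≤1+n 2) 3≤∣V∣)
... | a , b , a∈ , b∈ , a<b , bounds =
  proj₁ triangulation ,
  hull-IsTriangulation bounds (proj₂ triangulation) ,
  Triangulates.good (proj₂ triangulation)
  where
  open Construction V (AllConds L M R)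
  open Splitting hLR hLMR hMM V (λ (seg , gap) → sides-good _ (seg , inj₁ gap))

  hull-good : AllConds L M R (a , b)
  hull-good = sides-good _ ((a<b , a∈ , b∈) , inj₂ λ c c∈ →
    (λ c<a → <⇒≱ c<a (proj₁ (bounds c∈))) , (λ b<c → <⇒≱ b<c (proj₂ (bounds c∈))))

  triangulation : ∃ (Triangulates V (AllConds L M R) a b)
  triangulation = triangulate split (a<b , a∈ , b∈) hull-good
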